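{- Let $(G,\bm{\gamma})$ be a cone-Laman-sparse $\mathbb{Z}/3\mathbb{Z}$-colored graph with development $\tilde G$ and covering map $\pi$. A subgraph $G'$ of $G$ is a cone-Laman rigid component of $(G,\bm{\gamma})$ if and only if $\pi^{ -1}(G')$ is a symmetric $(2,3)$-component of $\tilde{G}$.
   Context: A $\mathbb{Z}/3\mathbb{Z}$-colored graph is a finite directed (multi)graph $G=(V,E)$ with an element $\gamma_{ij}\in\mathbb{Z}/3\mathbb{Z}$ for each edge $ij$. For a cycle $C$ with a traversal order, $\rho(C)=\sum_{\text{forward}}\gamma_{ij}-\sum_{\text{backward}}\gamma_{ij}$; a subgraph has trivial image if $\rho(C)=0$ for every cycle in it, non-trivial otherwise. For a subgraph, $n'$ is the number of vertices it spans, $m'$ its number of edges. $(G,\bm{\gamma})$ is cone-Laman-sparse if every non-empty subgraph with trivial image has $m'\le 2n'-3$ and every one with non-trivial image has $m'\le 2n'-1$; its cone-Laman rigid components are its maximal subgraphs with $m'=2n'-1$. The development $\tilde G$ has vertices $i_0,i_1,i_2$ for each $i\in V$ and, for each directed edge $ij$, the undirected edges $i_tj_{t+\gamma_{ij}}$, $t\in\{0,1,2\}$ (mod 3); $\pi:\tilde G\to G$ sends $i_t\mapsto i$ and $i_tj_{t+\gamma_{ij}}\mapsto ij$. The $(2,3)$-components of a Laman-sparse graph (every non-empty subgraph has $m'\le 2n'-3$) are its maximal subgraphs with $m'=2n'-3$. $\mathbb{Z}/3\mathbb{Z}$ acts on $\tilde G$ by $i_t\mapsto i_{t+z}$, and a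 subgraph of $\tilde G$ is symmetric if it is invariant under this action. -}

module Defs where

open import Data.Nat using (ℕ; zero; suc; _+_; _*_; _∸_; _≤_)
open import Data.Nat.DivMod using (_mod_)
open import Data.Fin using (Fin; toℕ; combine; remQuot)
open import Data.Fin.Properties using (any?; _≟_)
open import Data.Fin.Subset using (Subset; _∈_; _⊆_; ∣_∣; Nonempty)
open import Data.Fin.Subset.Properties using (_∈?_)
open import Data.Vec using (tabulate; lookup)
open import Data.Bool using (Bool; true; false)
open import Data.List using (List; []; _∷_; map)
open import Data.List.Relation.Unary.All using (All)
open import Data.List.Relation.Unary.Unique.Propositional using (Unique)
open import Data.Product using (Σ; _×_; _,_; proj₁; proj₂; ∃)
open import Data.Sum using (_⊎_)
open import Relation.Nullary using (¬_)
open import Relation.Nullary.Decidable using (⌊_⌋; _×-dec_; _⊎-dec_)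
open import Relation.Binary.PropositionalEquality using (_≡_)

ℤ₃ : Set
ℤ₃ = Fin 3

infixl 6 _+₃_ _-₃_

_+₃_ : ℤ₃ → ℤ₃ → ℤ₃
a +₃ b = (toℕ a + toℕ b) mod 3

-₃_ : ℤ₃ → ℤ₃
-₃ a = (3 ∸ toℕ a) mod 3

_-₃_ : ℤ₃ → ℤ₃ → ℤ₃
a -₃ b = a +₃ (-₃ b)

0₃ : ℤ₃
0₃ = Fin.zero

-- Finite (multi)graphs: vertices Fin n, edges Fin m, each edge e has
-- endpoints src e and tgt e (loops and parallel edges allowed).
-- For an undirected graph the orientation is irrelevant.

record Graph (n m : ℕ) : Set where
  field
    src : Fin m → Fin n
    tgt : Fin m → Fin n
open Graph public

-- A subgraph is given by its edge set S; it spans the endpoints of its edges.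
module _ {n m : ℕ} (G : Graph n m) where

  spanned : Subset m → Subset n
  spanned S = tabulate λ v →
    ⌊ any? (λ e → (e ∈? S) ×-dec ((src G e ≟ v) ⊎-dec (tgt G e ≟ v))) ⌋

  n' : Subset m → ℕ
  n' S = ∣ spanned S ∣

  m' : Subset m → ℕ
  m' S = ∣ S ∣

Maximal : {m : ℕ} → (Subset m → Set) → Subset m → Set
Maximal {m} P S = P S × (∀ (T : Subset m) → P T → S ⊆ T → T ≡ S)

-- (2,3)-sparsity and (2,3)-components (counts m' ≤ 2n'-3 written m'+3 ≤ 2n')

LamanSparse : {n m : ℕ} → Graph n m → Set
LamanSparse {n} {m} G = ∀ (S : Subset m) → Nonempty S → m' G S + 3 ≤ 2 * n' G S

Component23 : {n m : ℕ} → Graph n m → Subset m → Set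
Component23 G = Maximal (λ T → m' G T + 3 ≡ 2 * n' G T)

record ColGraph (n m : ℕ) : Set where
  field
    graph : Graph n m
    γ     : Fin m → ℤ₃
open ColGraph public

module _ {n m : ℕ} (G : ColGraph n m) where

  -- a traversal step: an edge together with a direction (true = forward)
  Step : Set
  Step = Fin m × Bool

  from : Step → Fin n
  from (e , true)  = src (graph G) e
  from (e , false) = tgt (graph G) e

  to : Step → Fin n
  to (e , true)  = tgt (graph G) e
  to (e , false) = src (graph G) e

  data IsWalk : Fin n → List Step → Fin n → Set where
    []  : ∀ {u} → IsWalk u [] u
    _∷_ : ∀ {u w s ss} → from s ≡ u → IsWalk (to s) ss w → IsWalk u (s ∷ ss) w

  IsCycle : Subset m → Fin n → List Step → Set
  IsCycle S u ss =
    ¬ (ss ≡ []) × IsWalk u ss u × All (λ s → proj₁ s ∈ S) ss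
    × Unique (map proj₁ ss) × Unique (map from ss)

  stepVal : Step → ℤ₃
  stepVal (e , true)  = γ G e
  stepVal (e , false) = -₃ (γ G e)

  ρ : List Step → ℤ₃
  ρ []       = 0₃
  ρ (s ∷ ss) = stepVal s +₃ ρ ss

  TrivialImage : Subset m → Set
  TrivialImage S = ∀ (u : Fin n) (ss : List Step) → IsCycle S u ss → ρ ss ≡ 0₃

  ConeLamanSparse : Set
  ConeLamanSparse = ∀ (S : Subset m) → Nonempty S →
      (TrivialImage S → m' (graph G) S + 3 ≤ 2 * n' (graph G) S)
    × (¬ TrivialImage S → m' (graph G) S + 1 ≤ 2 * n' (graph G) S)

  ConeLamanRigidComponent : Subset m → Set
  ConeLamanRigidComponent = Maximal (λ T → m' (graph G) T + 1 ≡ 2 * n' (graph G) T)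

  -- The development G̃: vertex i_t is  combine i t : Fin (n * 3),
  -- edge (ij, t) is  combine e t : Fin (m * 3), joining i_t and j_{t+γ_ij}.

  eOf : Fin (m * 3) → Fin m
  eOf k = proj₁ (remQuot {m} 3 k)

  tE : Fin (m * 3) → ℤ₃
  tE k = proj₂ (remQuot {m} 3 k)

  vOf : Fin (n * 3) → Fin n
  vOf k = proj₁ (remQuot {n} 3 k)

  tV : Fin (n * 3) → ℤ₃
  tV k = proj₂ (remQuot {n} 3 k)

  development : Graph (n * 3) (m * 3)
  development = record
    { src = λ k → combine (src (graph G) (eOf k)) (tE k)
    ; tgt = λ k → combine (tgt (graph G) (eOf k)) (tE k +₃ γ G (eOf k))
    }

  πE : Fin (m * 3) → Fin m
  πE = eOf

  πV : Fin (n * 3) → Fin n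
  πV = vOf

  preimage : Subset m → Subset (m * 3)
  preimage S = tabulate λ k → lookup S (πE k)

  actV : ℤ₃ → Fin (n * 3) → Fin (n * 3)
  actV z k = combine (vOf k) (tV k +₃ z)

  actE : ℤ₃ → Fin (m * 3) → Fin (m * 3)
  actE z k = combine (eOf k) (tE k +₃ z)

  Symmetric : Subset (m * 3) → Set
  Symmetric T = ∀ (z : ℤ₃) (k : Fin (m * 3)) → k ∈ T → actE z k ∈ T

module Submission where

-- Counting: P has 3m' edges on 3n' vertices, so the (2,1)-count m' = 2n' − 1
-- downstairs is exactly the (2,3)-count upstairs.  For the forward
-- one, symmetric supersets of P are preimages, hence (2,3)-sparse by the
-- cone-Laman count and tight only for P itself.  An arbitrary superset W of P
-- is handled by gluing it with its ℤ/3ℤ-translates: vertex counts are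
-- submodular and edge counts modular, so the union of two sets with defects a
-- and b along a sparse intersection has defect a + b − 3.  By induction on |W|
-- every superset of P is sparse, and a tight one generates a tight symmetric
-- orbit, which must be P.

open import Defs
open import Data.Nat using (ℕ; zero; suc; _+_; _*_; _≤_; _<_; z≤n; s≤s; _≤?_)
open import Data.Nat.Properties
  using (≤-refl; ≤-trans; ≤-reflexive; ≤-antisym; +-mono-≤; +-monoʳ-≤; *-monoʳ-≤; *-distribˡ-+; *-suc;
         +-suc; +-cancelʳ-≤; *-cancelˡ-≡; ≰⇒>; ≤-pred; 1+n≰n; +-0-commutativeMonoid; module ≤-Reasoning)
open import Data.Nat.Induction using (<-wellFounded)
open import Data.Nat.Tactic.RingSolver using (solve-∀)
open import Data.Bool using (Bool; true; false; T)
open import Data.Bool.Properties using (T-≡)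
open import Data.Fin using (Fin; zero; suc; combine; remQuot)
open import Data.Fin.Properties using (all?; any?; _≟_; remQuot-combine; combine-remQuot)
open import Data.Fin.Permutation using (Permutation′; permutation; _⟨$⟩ʳ_)
open import Data.Fin.Subset using (Subset; _∈_; _∉_; _⊆_; ∣_∣; Nonempty; Empty; _∪_; _∩_)
open import Data.Fin.Subset.Properties
  using (_∈?_; ⊆-antisym; nonempty?; Empty-unique; ∣⊥∣≡0; p⊆q⇒∣p∣≤∣q∣; p⊂q⇒∣p∣<∣q∣;
         p∩q⊆p; p∩q⊆q; x∈p∩q⁺; x∈p∩q⁻; x∈p∪q⁺; x∈p∪q⁻)
open import Data.Vec using ([]; _∷_; tabulate; lookup)
open import Data.Vec.Properties using (lookup∘tabulate; []=⇒lookup; lookup⇒[]=)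
open import Data.Product using (_×_; _,_; proj₁; proj₂; ∃)
open import Data.Sum using (_⊎_; inj₁; inj₂; [_,_]′)
open import Data.Empty using (⊥; ⊥-elim)
open import Function using (_∘_)
open import Function.Bundles using (_⇔_; mk⇔; Equivalence)
open import Induction.WellFounded using (module All)
import Relation.Binary.Construct.On as On
open import Relation.Nullary using (¬_; Dec; yes; no)
open import Relation.Nullary.Decidable using (⌊_⌋; from-yes; decidable-stable; toWitness; fromWitness; ¬?; _×-dec_; _⊎-dec_)
open import Relation.Binary.PropositionalEquality
import Algebra.Properties.CommutativeMonoid.Sum as MonoidSum

+₃-assoc : ∀ a b c → (a +₃ b) +₃ c ≡ a +₃ (b +₃ c)
+₃-assoc = from-yes (all? λ a → all? λ b → all? λ c → (a +₃ b) +₃ c ≟ a +₃ (b +₃ c))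

+₃-comm : ∀ a b → a +₃ b ≡ b +₃ a
+₃-comm = from-yes (all? λ a → all? λ b → a +₃ b ≟ b +₃ a)

+₃-identityˡ : ∀ a → 0₃ +₃ a ≡ a
+₃-identityˡ = from-yes (all? λ a → 0₃ +₃ a ≟ a)

+₃-identityʳ : ∀ a → a +₃ 0₃ ≡ a
+₃-identityʳ = from-yes (all? λ a → a +₃ 0₃ ≟ a)

-₃-inverseˡ : ∀ a → (-₃ a) +₃ a ≡ 0₃
-₃-inverseˡ = from-yes (all? λ a → (-₃ a) +₃ a ≟ 0₃)

-₃-inverseʳ : ∀ a → a +₃ (-₃ a) ≡ 0₃
-₃-inverseʳ = from-yes (all? λ a → a +₃ (-₃ a) ≟ 0₃)

+₃-swapʳ : ∀ a b c → (a +₃ b) +₃ c ≡ (a +₃ c) +₃ b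
+₃-swapʳ a b c = begin
  (a +₃ b) +₃ c  ≡⟨ +₃-assoc a b c ⟩
  a +₃ (b +₃ c)  ≡⟨ cong (a +₃_) (+₃-comm b c) ⟩
  a +₃ (c +₃ b)  ≡⟨ +₃-assoc a c b ⟨
  (a +₃ c) +₃ b  ∎
  where open ≡-Reasoning

-₃-cancel : ∀ a b → (a -₃ b) +₃ b ≡ a
-₃-cancel a b = begin
  (a +₃ (-₃ b)) +₃ b  ≡⟨ +₃-assoc a (-₃ b) b ⟩
  a +₃ ((-₃ b) +₃ b)  ≡⟨ cong (a +₃_) (-₃-inverseˡ b) ⟩
  a +₃ 0₃             ≡⟨ +₃-identityʳ a ⟩
  a                   ∎
  where open ≡-Reasoning

∈-tabulate⁻ : ∀ {k} (f : Fin k → Bool) {x} → x ∈ tabulate f → f x ≡ true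
∈-tabulate⁻ f {x} x∈ = trans (sym (lookup∘tabulate f x)) ([]=⇒lookup x∈)

∈-tabulate⁺ : ∀ {k} (f : Fin k → Bool) {x} → f x ≡ true → x ∈ tabulate f
∈-tabulate⁺ f {x} fx = lookup⇒[]= x _ (trans (lookup∘tabulate f x) fx)

reindex : ∀ {k l} → (Fin k → Fin l) → Subset l → Subset k
reindex f S = tabulate (λ x → lookup S (f x))

∈-reindex⁻ : ∀ {k l} (f : Fin k → Fin l) {S x} → x ∈ reindex f S → f x ∈ S
∈-reindex⁻ f {S} x∈ = lookup⇒[]= _ S (∈-tabulate⁻ (λ x → lookup S (f x)) x∈)

∈-reindex⁺ : ∀ {k l} (f : Fin k → Fin l) {S x} → f x ∈ S → x ∈ reindex f S
∈-reindex⁺ f {S} fx∈ = ∈-tabulate⁺ (λ x → lookup S (f x)) ([]=⇒lookup fx∈)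

∣p∪q∣+∣p∩q∣ : ∀ {k} (p q : Subset k) → ∣ p ∪ q ∣ + ∣ p ∩ q ∣ ≡ ∣ p ∣ + ∣ q ∣
∣p∪q∣+∣p∩q∣ []           []           = refl
∣p∪q∣+∣p∩q∣ (true ∷ p)  (true ∷ q)  =
  cong suc (trans (+-suc _ _) (trans (cong suc (∣p∪q∣+∣p∩q∣ p q)) (sym (+-suc _ _))))
∣p∪q∣+∣p∩q∣ (true ∷ p)  (false ∷ q) = cong suc (∣p∪q∣+∣p∩q∣ p q)
∣p∪q∣+∣p∩q∣ (false ∷ p) (true ∷ q)  = trans (cong suc (∣p∪q∣+∣p∩q∣ p q)) (sym (+-suc _ _))
∣p∪q∣+∣p∩q∣ (false ∷ p) (false ∷ q) = ∣p∪q∣+∣p∩q∣ p q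

-- Reindexing along a permutation preserves cardinality; the cardinality is
-- written as a sum of indicator values so that the sum can be permuted.
module _ where
  open MonoidSum +-0-commutativeMonoid using (sum; sum-permute; sum-cong-≗)

  indicator : Bool → ℕ
  indicator true  = 1
  indicator false = 0

  ∣∣-sum : ∀ {k} (p : Subset k) → ∣ p ∣ ≡ sum (indicator ∘ lookup p)
  ∣∣-sum []          = refl
  ∣∣-sum (true ∷ p)  = cong suc (∣∣-sum p)
  ∣∣-sum (false ∷ p) = ∣∣-sum p

  ∣reindex∣-permutation : ∀ {k} (σ : Permutation′ k) (S : Subset k) →
    ∣ reindex (σ ⟨$⟩ʳ_) S ∣ ≡ ∣ S ∣
  ∣reindex∣-permutation σ S = begin
    ∣ reindex (σ ⟨$⟩ʳ_) S ∣                      ≡⟨ ∣∣-sum (reindex (σ ⟨$⟩ʳ_) S) ⟩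
    sum (indicator ∘ lookup (reindex (σ ⟨$⟩ʳ_) S)) ≡⟨ sum-cong-≗ (cong indicator ∘ lookup∘tabulate (λ i → lookup S (σ ⟨$⟩ʳ i))) ⟩
    sum (λ i → indicator (lookup S (σ ⟨$⟩ʳ i)))   ≡⟨ sum-permute (indicator ∘ lookup S) σ ⟨
    sum (indicator ∘ lookup S)                     ≡⟨ ∣∣-sum S ⟨
    ∣ S ∣                                          ∎
    where open ≡-Reasoning

⊆-or-witness : ∀ {k} (p q : Subset k) → p ⊆ q ⊎ ∃ λ x → x ∈ p × x ∉ q
⊆-or-witness p q with any? (λ x → (x ∈? p) ×-dec ¬? (x ∈? q))
... | yes w   = inj₂ w
... | no none = inj₁ λ {x} x∈p → decidable-stable (x ∈? q) (λ x∉q → none (x , x∈p , x∉q))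

∣p∩q∣<∣p∣ : ∀ {k} (p q : Subset k) {x} → x ∈ p → x ∉ q → ∣ p ∩ q ∣ < ∣ p ∣
∣p∩q∣<∣p∣ p q {x} x∈p x∉q =
  p⊂q⇒∣p∣<∣q∣ (p∩q⊆p p q , x , x∈p , λ x∈p∩q → x∉q (proj₂ (x∈p∩q⁻ p q x∈p∩q)))

∣p∩q∣<∣q∣ : ∀ {k} (p q : Subset k) {x} → x ∈ q → x ∉ p → ∣ p ∩ q ∣ < ∣ q ∣
∣p∩q∣<∣q∣ p q {x} x∈q x∉p =
  p⊂q⇒∣p∣<∣q∣ (p∩q⊆q p q , x , x∈q , λ x∈p∩q → x∉p (proj₁ (x∈p∩q⁻ p q x∈p∩q)))

module _ {n m : ℕ} (H : Graph n m) where

  Incident : Fin m → Fin n → Set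
  Incident e v = src H e ≡ v ⊎ tgt H e ≡ v

  -- the decision procedure by which `spanned` is defined
  incident? : ∀ S v → Dec (∃ λ e → e ∈ S × Incident e v)
  incident? S v = any? (λ e → (e ∈? S) ×-dec ((src H e ≟ v) ⊎-dec (tgt H e ≟ v)))

  ∈-spanned⁻ : ∀ S {v} → v ∈ spanned H S → ∃ λ e → e ∈ S × Incident e v
  ∈-spanned⁻ S {v} v∈ =
    toWitness {a? = incident? S v} (Equivalence.from T-≡ (∈-tabulate⁻ (⌊_⌋ ∘ incident? S) v∈))

  ∈-spanned⁺ : ∀ S {e v} → e ∈ S → Incident e v → v ∈ spanned H S
  ∈-spanned⁺ S {e} {v} e∈ inc =
    ∈-tabulate⁺ (⌊_⌋ ∘ incident? S) (Equivalence.to T-≡ (fromWitness {a? = incident? S v} (e , e∈ , inc)))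

  spanned-∪ : ∀ S T → spanned H (S ∪ T) ⊆ spanned H S ∪ spanned H T
  spanned-∪ S T v∈ with ∈-spanned⁻ (S ∪ T) v∈
  ... | e , e∈ , inc with x∈p∪q⁻ S T e∈
  ...   | inj₁ e∈S = x∈p∪q⁺ (inj₁ (∈-spanned⁺ S e∈S inc))
  ...   | inj₂ e∈T = x∈p∪q⁺ (inj₂ (∈-spanned⁺ T e∈T inc))

  spanned-∩ : ∀ S T → spanned H (S ∩ T) ⊆ spanned H S ∩ spanned H T
  spanned-∩ S T v∈ with ∈-spanned⁻ (S ∩ T) v∈
  ... | e , e∈ , inc with x∈p∩q⁻ S T e∈
  ...   | e∈S , e∈T = x∈p∩q⁺ (∈-spanned⁺ S e∈S inc , ∈-spanned⁺ T e∈T inc)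

  n'-submodular : ∀ S T → n' H (S ∪ T) + n' H (S ∩ T) ≤ n' H S + n' H T
  n'-submodular S T = ≤-trans (+-mono-≤ (p⊆q⇒∣p∣≤∣q∣ (spanned-∪ S T)) (p⊆q⇒∣p∣≤∣q∣ (spanned-∩ S T)))
                              (≤-reflexive (∣p∪q∣+∣p∩q∣ (spanned H S) (spanned H T)))

  m'-modular : ∀ S T → m' H (S ∪ T) + m' H (S ∩ T) ≡ m' H S + m' H T
  m'-modular = ∣p∪q∣+∣p∩q∣

union-count : ∀ {nA nB nU nI mA mB mU mI a b c} →
  nU + nI ≤ nA + nB → mU + mI ≡ mA + mB →
  2 * nA ≤ mA + a → 2 * nB ≤ mB + b → mI + 3 ≤ 2 * nI → a + b ≡ c + 3 → 2 * nU ≤ mU + c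
union-count {nA} {nB} {nU} {nI} {mA} {mB} {mU} {mI} {a} {b} {c} n-sub m-mod A-dense B-dense I-sparse abc =
  +-cancelʳ-≤ (2 * nI) (2 * nU) (mU + c) (begin
    2 * nU + 2 * nI      ≡⟨ *-distribˡ-+ 2 nU nI ⟨
    2 * (nU + nI)        ≤⟨ *-monoʳ-≤ 2 n-sub ⟩
    2 * (nA + nB)        ≡⟨ *-distribˡ-+ 2 nA nB ⟩
    2 * nA + 2 * nB      ≤⟨ +-mono-≤ A-dense B-dense ⟩
    (mA + a) + (mB + b)  ≡⟨ interchange mA a mB b ⟩
    (mA + mB) + (a + b)  ≡⟨ cong₂ _+_ (sym m-mod) abc ⟩
    (mU + mI) + (c + 3)  ≡⟨ interchange mU mI c 3 ⟩
    (mU + c) + (mI + 3)  ≤⟨ +-monoʳ-≤ (mU + c) I-sparse ⟩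
    mU + c + 2 * nI      ∎)
  where
  open ≤-Reasoning
  interchange : ∀ w x y z → (w + x) + (y + z) ≡ (w + y) + (x + z)
  interchange = solve-∀

-- Tripling both counts turns the (2,1)-count into the (2,3)-count.
tripleˡ : ∀ a → 3 * (a + 1) ≡ 3 * a + 3
tripleˡ = solve-∀

tripleʳ : ∀ b → 3 * (2 * b) ≡ 2 * (3 * b)
tripleʳ = solve-∀

triple-≤ : ∀ {a b} → a + 1 ≤ 2 * b → 3 * a + 3 ≤ 2 * (3 * b)
triple-≤ {a} {b} le = subst₂ _≤_ (tripleˡ a) (tripleʳ b) (*-monoʳ-≤ 3 le)

triple-≡ : ∀ {a b} → a + 1 ≡ 2 * b ⇔ 3 * a + 3 ≡ 2 * (3 * b)
triple-≡ {a} {b} = mk⇔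
  (λ eq → trans (sym (tripleˡ a)) (trans (cong (3 *_) eq) (tripleʳ b)))
  (λ eq → *-cancelˡ-≡ (a + 1) (2 * b) 3 (trans (tripleˡ a) (trans eq (sym (tripleʳ b)))))

module _ {n m : ℕ} (H : Graph n m) where

  Tight₂₁ : Subset m → Set
  Tight₂₁ W = m' H W + 1 ≡ 2 * n' H W

  -- A subgraph with m' + 1 = 2n' has an edge (the empty one spans nothing).
  Tight₂₁⇒Nonempty : ∀ S → Tight₂₁ S → Nonempty S
  Tight₂₁⇒Nonempty S tight with nonempty? S
  ... | yes ne  = ne
  ... | no  ¬ne = ⊥-elim (0+1≢0 (begin
    0 + 1       ≡⟨ cong (_+ 1) (trans (cong ∣_∣ (Empty-unique ¬ne)) (∣⊥∣≡0 m)) ⟨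
    m' H S + 1  ≡⟨ tight ⟩
    2 * n' H S  ≡⟨ cong (2 *_) (trans (cong ∣_∣ (Empty-unique nothing-spanned)) (∣⊥∣≡0 n)) ⟩
    2 * 0       ∎))
    where
    open ≡-Reasoning
    nothing-spanned : Empty (spanned H S)
    nothing-spanned (v , v∈) = ¬ne (proj₁ (∈-spanned⁻ H S v∈) , proj₁ (proj₂ (∈-spanned⁻ H S v∈)))
    0+1≢0 : ¬ (0 + 1 ≡ 2 * 0)
    0+1≢0 ()

  Sparse₂₃ : Subset m → Set
  Sparse₂₃ W = m' H W + 3 ≤ 2 * n' H W

  Tight₂₃ : Subset m → Set
  Tight₂₃ W = m' H W + 3 ≡ 2 * n' H W

  -- W has defect at most c:  m' ≥ 2n' − c
  Dense : ℕ → Subset m → Set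
  Dense c W = 2 * n' H W ≤ m' H W + c

  -- gluing along a sparse intersection, by submodularity of the vertex count
  dense-∪ : ∀ {a b c} A B → Dense a A → Dense b B → Sparse₂₃ (A ∩ B) → a + b ≡ c + 3 → Dense c (A ∪ B)
  dense-∪ {a} {b} {c} A B = union-count {n' H A} {n' H B} {n' H (A ∪ B)} {n' H (A ∩ B)}
    {m' H A} {m' H B} {m' H (A ∪ B)} {m' H (A ∩ B)} {a} {b} {c} (n'-submodular H A B) (m'-modular H A B)

  ¬sparse⇒dense : ∀ W → ¬ Sparse₂₃ W → Dense 2 W
  ¬sparse⇒dense W ¬sparse = ≤-pred (subst (2 * n' H W <_) (+-suc (m' H W) 2) (≰⇒> ¬sparse))

  sparse-¬dense : ∀ {c} W → Sparse₂₃ W → Dense c W → c ≤ 2 → ⊥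
  sparse-¬dense {c} W sparse dense c≤2 = 1+n≰n (subst (_≤ m' H W + 2) (+-suc (m' H W) 2)
    (≤-trans sparse (≤-trans dense (+-monoʳ-≤ (m' H W) c≤2))))

  sparse-dense-tight : ∀ W → Sparse₂₃ W → Dense 3 W → Tight₂₃ W
  sparse-dense-tight W = ≤-antisym

-- A graph homomorphism K → H along which every edge incident with the image
-- of a vertex lifts to an edge at that vertex, in the same role (the lifting
-- half of the definition of a covering map).
record Covering {n₁ m₁ n₂ m₂ : ℕ} (K : Graph n₁ m₁) (H : Graph n₂ m₂) : Set where
  field
    vmap     : Fin n₁ → Fin n₂
    emap     : Fin m₁ → Fin m₂
    src-hom  : ∀ e → src H (emap e) ≡ vmap (src K e)
    tgt-hom  : ∀ e → tgt H (emap e) ≡ vmap (tgt K e)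
    src-lift : ∀ v e → src H e ≡ vmap v → ∃ λ ẽ → emap ẽ ≡ e × src K ẽ ≡ v
    tgt-lift : ∀ v e → tgt H e ≡ vmap v → ∃ λ ẽ → emap ẽ ≡ e × tgt K ẽ ≡ v

spanned-pullback : ∀ {n₁ m₁ n₂ m₂} {K : Graph n₁ m₁} {H : Graph n₂ m₂} (c : Covering K H) →
  ∀ S → spanned K (reindex (Covering.emap c) S) ≡ reindex (Covering.vmap c) (spanned H S)
spanned-pullback {K = K} {H} c S = ⊆-antisym push pull
  where
  open Covering c

  push : spanned K (reindex emap S) ⊆ reindex vmap (spanned H S)
  push v∈ with ∈-spanned⁻ K (reindex emap S) v∈
  ... | e , e∈ , inj₁ refl = ∈-reindex⁺ vmap (∈-spanned⁺ H S (∈-reindex⁻ emap e∈) (inj₁ (src-hom e)))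
  ... | e , e∈ , inj₂ refl = ∈-reindex⁺ vmap (∈-spanned⁺ H S (∈-reindex⁻ emap e∈) (inj₂ (tgt-hom e)))

  pull : reindex vmap (spanned H S) ⊆ spanned K (reindex emap S)
  pull {v} v∈ with ∈-spanned⁻ H S (∈-reindex⁻ vmap v∈)
  ... | e , e∈ , inj₁ e-src with src-lift v e e-src
  ...   | ẽ , refl , ẽ-src = ∈-spanned⁺ K (reindex emap S) (∈-reindex⁺ emap e∈) (inj₁ ẽ-src)
  pull {v} v∈ | e , e∈ , inj₂ e-tgt with tgt-lift v e e-tgt
  ...   | ẽ , refl , ẽ-tgt = ∈-spanned⁺ K (reindex emap S) (∈-reindex⁺ emap e∈) (inj₂ ẽ-tgt)

module Sheets (N : ℕ) where

  base : Fin (N * 3) → Fin N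
  base k = proj₁ (remQuot {N} 3 k)

  sheet : Fin (N * 3) → ℤ₃
  sheet k = proj₂ (remQuot {N} 3 k)

  base-combine : ∀ (i : Fin N) t → base (combine i t) ≡ i
  base-combine i t = cong proj₁ (remQuot-combine i t)

  sheet-combine : ∀ (i : Fin N) t → sheet (combine i t) ≡ t
  sheet-combine i t = cong proj₂ (remQuot-combine i t)

  combine-base-sheet : ∀ k → combine (base k) (sheet k) ≡ k
  combine-base-sheet k = combine-remQuot {N} 3 k

  rotate : ℤ₃ → Fin (N * 3) → Fin (N * 3)
  rotate z k = combine (base k) (sheet k +₃ z)

  rotate-combine : ∀ z (i : Fin N) t → rotate z (combine i t) ≡ combine i (t +₃ z)
  rotate-combine z i t = cong₂ (λ j s → combine j (s +₃ z)) (base-combine i t) (sheet-combine i t)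

  base-rotate : ∀ z k → base (rotate z k) ≡ base k
  base-rotate z k = base-combine (base k) _

  sheet-rotate : ∀ z k → sheet (rotate z k) ≡ sheet k +₃ z
  sheet-rotate z k = sheet-combine (base k) _

  rotate-0 : ∀ k → rotate 0₃ k ≡ k
  rotate-0 k = trans (cong (combine (base k)) (+₃-identityʳ (sheet k))) (combine-base-sheet k)

  rotate-∘ : ∀ a b k → rotate a (rotate b k) ≡ rotate (b +₃ a) k
  rotate-∘ a b k = trans (rotate-combine a (base k) (sheet k +₃ b))
                         (cong (combine (base k)) (+₃-assoc (sheet k) b a))

  rotate-inverse : ∀ a b → a +₃ b ≡ 0₃ → ∀ k → rotate b (rotate a k) ≡ k
  rotate-inverse a b a+b≡0 k =
    trans (rotate-∘ b a k) (trans (cong (λ z → rotate z k) a+b≡0) (rotate-0 k))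

  rotation : ℤ₃ → Permutation′ (N * 3)
  rotation z = permutation (rotate z) (rotate (-₃ z))
    (rotate-inverse (-₃ z) z (-₃-inverseˡ z)) (rotate-inverse z (-₃ z) (-₃-inverseʳ z))

∣reindex-base∣ : ∀ {N} (T : Subset N) → ∣ reindex (Sheets.base N) T ∣ ≡ 3 * ∣ T ∣
∣reindex-base∣ []                  = refl
∣reindex-base∣ {suc N} (true ∷ T)  = trans (cong (3 +_) (∣reindex-base∣ T)) (sym (*-suc 3 ∣ T ∣))
∣reindex-base∣ {suc N} (false ∷ T) = ∣reindex-base∣ T

-- Rotating the sheets is an
-- automorphism of it, and π is a covering; hence both transport spans, which
-- yields the counting rules for translates and preimages of edge sets.
module Development {n m : ℕ} (G : ColGraph n m) where

  module E = Sheets m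
  module V = Sheets n

  H : Graph n m
  H = graph G

  D : Graph (n * 3) (m * 3)
  D = development G

  src-rotate : ∀ z k → src D (E.rotate z k) ≡ V.rotate z (src D k)
  src-rotate z k = begin
    combine (src H (E.base (E.rotate z k))) (E.sheet (E.rotate z k))
      ≡⟨ cong₂ (λ e t → combine (src H e) t) (E.base-rotate z k) (E.sheet-rotate z k) ⟩
    combine (src H (E.base k)) (E.sheet k +₃ z)
      ≡⟨ V.rotate-combine z (src H (E.base k)) (E.sheet k) ⟨
    V.rotate z (combine (src H (E.base k)) (E.sheet k)) ∎
    where open ≡-Reasoning

  tgt-rotate : ∀ z k → tgt D (E.rotate z k) ≡ V.rotate z (tgt D k)
  tgt-rotate z k = begin
    combine (tgt H (E.base (E.rotate z k))) (E.sheet (E.rotate z k) +₃ γ G (E.base (E.rotate z k)))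
      ≡⟨ cong₂ (λ e t → combine (tgt H e) (t +₃ γ G e)) (E.base-rotate z k) (E.sheet-rotate z k) ⟩
    combine (tgt H b) ((E.sheet k +₃ z) +₃ γ G b)
      ≡⟨ cong (combine (tgt H b)) (+₃-swapʳ (E.sheet k) z (γ G b)) ⟩
    combine (tgt H b) ((E.sheet k +₃ γ G b) +₃ z)
      ≡⟨ V.rotate-combine z (tgt H b) (E.sheet k +₃ γ G b) ⟨
    V.rotate z (combine (tgt H b) (E.sheet k +₃ γ G b)) ∎
    where
    open ≡-Reasoning
    b = E.base k

  rotation-covering : ℤ₃ → Covering D D
  rotation-covering z = record
    { vmap     = V.rotate z
    ; emap     = E.rotate z
    ; src-hom  = src-rotate z
    ; tgt-hom  = tgt-rotate z
    ; src-lift = λ v e e-src → E.rotate (-₃ z) e , undo e ,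
        trans (src-rotate (-₃ z) e) (trans (cong (V.rotate (-₃ z)) e-src) (back v))
    ; tgt-lift = λ v e e-tgt → E.rotate (-₃ z) e , undo e ,
        trans (tgt-rotate (-₃ z) e) (trans (cong (V.rotate (-₃ z)) e-tgt) (back v))
    }
    where
    undo : ∀ e → E.rotate z (E.rotate (-₃ z) e) ≡ e
    undo = E.rotate-inverse (-₃ z) z (-₃-inverseˡ z)
    back : ∀ v → V.rotate (-₃ z) (V.rotate z v) ≡ v
    back = V.rotate-inverse z (-₃ z) (-₃-inverseʳ z)

  projection-covering : Covering D H
  projection-covering = record
    { vmap     = V.base
    ; emap     = E.base
    ; src-hom  = λ k → sym (V.base-combine (src H (E.base k)) (E.sheet k))
    ; tgt-hom  = λ k → sym (V.base-combine (tgt H (E.base k)) (E.sheet k +₃ γ G (E.base k)))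
    ; src-lift = λ v e e-src → combine e (V.sheet v) , E.base-combine e (V.sheet v) , (begin
        combine (src H (E.base (combine e (V.sheet v)))) (E.sheet (combine e (V.sheet v)))
          ≡⟨ cong₂ (λ e t → combine (src H e) t) (E.base-combine e (V.sheet v)) (E.sheet-combine e (V.sheet v)) ⟩
        combine (src H e) (V.sheet v)     ≡⟨ cong (λ i → combine i (V.sheet v)) e-src ⟩
        combine (V.base v) (V.sheet v)    ≡⟨ V.combine-base-sheet v ⟩
        v ∎)
    ; tgt-lift = λ v e e-tgt → let t = V.sheet v -₃ γ G e in combine e t , E.base-combine e t , (begin
        combine (tgt H (E.base (combine e t))) (E.sheet (combine e t) +₃ γ G (E.base (combine e t)))
          ≡⟨ cong₂ (λ e t → combine (tgt H e) (t +₃ γ G e)) (E.base-combine e t) (E.sheet-combine e t) ⟩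
        combine (tgt H e) (t +₃ γ G e)    ≡⟨ cong₂ combine e-tgt (-₃-cancel (V.sheet v) (γ G e)) ⟩
        combine (V.base v) (V.sheet v)    ≡⟨ V.combine-base-sheet v ⟩
        v ∎)
    }
    where open ≡-Reasoning

  shift : ℤ₃ → Subset (m * 3) → Subset (m * 3)
  shift z = reindex (E.rotate z)

  -- translation is a graph automorphism, so it preserves both counts
  n'-shift : ∀ z W → n' D (shift z W) ≡ n' D W
  n'-shift z W = trans (cong ∣_∣ (spanned-pullback (rotation-covering z) W))
                       (∣reindex∣-permutation (V.rotation z) (spanned D W))

  m'-shift : ∀ z W → m' D (shift z W) ≡ m' D W
  m'-shift z W = ∣reindex∣-permutation (E.rotation z) W

  n'-preimage : ∀ T → n' D (preimage G T) ≡ 3 * n' H T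
  n'-preimage T = trans (cong ∣_∣ (spanned-pullback projection-covering T)) (∣reindex-base∣ (spanned H T))

  m'-preimage : ∀ T → m' D (preimage G T) ≡ 3 * m' H T
  m'-preimage = ∣reindex-base∣

  preimage-mono : ∀ {T T'} → T ⊆ T' → preimage G T ⊆ preimage G T'
  preimage-mono T⊆T' k∈ = ∈-reindex⁺ E.base (T⊆T' (∈-reindex⁻ E.base k∈))

  preimage-reflects-⊆ : ∀ {T T'} → preimage G T ⊆ preimage G T' → T ⊆ T'
  preimage-reflects-⊆ {T} {T'} pre⊆ {e} e∈ = subst (_∈ T') (E.base-combine e 0₃)
    (∈-reindex⁻ E.base (pre⊆ (∈-reindex⁺ E.base (subst (_∈ T) (sym (E.base-combine e 0₃)) e∈))))

  preimage-symmetric : ∀ T → Symmetric G (preimage G T)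
  preimage-symmetric T z k k∈ =
    ∈-reindex⁺ E.base (subst (_∈ T) (sym (E.base-rotate z k)) (∈-reindex⁻ E.base k∈))

  symmetric⇒preimage : ∀ W → Symmetric G W → W ≡ preimage G (reindex (λ e → combine e 0₃) W)
  symmetric⇒preimage W sym-W = ⊆-antisym to-sheet-0 from-sheet-0
    where
    to-sheet-0 : W ⊆ preimage G (reindex (λ e → combine e 0₃) W)
    to-sheet-0 {k} k∈ = ∈-reindex⁺ E.base (∈-reindex⁺ (λ e → combine e 0₃)
      (subst (_∈ W) (cong (combine (E.base k)) (-₃-inverseʳ (E.sheet k))) (sym-W (-₃ E.sheet k) k k∈)))
    from-sheet-0 : preimage G (reindex (λ e → combine e 0₃) W) ⊆ W
    from-sheet-0 {k} k∈ = subst (_∈ W) back-to-k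
      (sym-W (E.sheet k) _ (∈-reindex⁻ (λ e → combine e 0₃) (∈-reindex⁻ E.base k∈)))
      where
      open ≡-Reasoning
      back-to-k : E.rotate (E.sheet k) (combine (E.base k) 0₃) ≡ k
      back-to-k = begin
        E.rotate (E.sheet k) (combine (E.base k) 0₃) ≡⟨ E.rotate-combine (E.sheet k) (E.base k) 0₃ ⟩
        combine (E.base k) (0₃ +₃ E.sheet k)        ≡⟨ cong (combine (E.base k)) (+₃-identityˡ (E.sheet k)) ⟩
        combine (E.base k) (E.sheet k)              ≡⟨ E.combine-base-sheet k ⟩
        k                                            ∎

  dense-shift : ∀ {c} z W → Dense D c W → Dense D c (shift z W)
  dense-shift {c} z W = subst₂ (λ a b → 2 * a ≤ b + c) (sym (n'-shift z W)) (sym (m'-shift z W))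

  preimage-sparse : ∀ T → m' H T + 1 ≤ 2 * n' H T → Sparse₂₃ D (preimage G T)
  preimage-sparse T le = subst₂ (λ a b → a + 3 ≤ 2 * b) (sym (m'-preimage T)) (sym (n'-preimage T)) (triple-≤ {m' H T} {n' H T} le)

  preimage-tight : ∀ T → Tight₂₁ H T ⇔ Tight₂₃ D (preimage G T)
  preimage-tight T = mk⇔
    (λ t → subst₂ (λ a b → a + 3 ≡ 2 * b) (sym (m'-preimage T)) (sym (n'-preimage T)) (Equivalence.to (triple-≡ {m' H T} {n' H T}) t))
    (λ t → Equivalence.from (triple-≡ {m' H T} {n' H T}) (subst₂ (λ a b → a + 3 ≡ 2 * b) (m'-preimage T) (n'-preimage T) t))

module Orbits {n m : ℕ} (G : ColGraph n m) where
  open Development G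

  1₃ 2₃ : ℤ₃
  1₃ = suc zero
  2₃ = suc (suc zero)

  orbit : Subset (m * 3) → Subset (m * 3)
  orbit W = (W ∪ shift 1₃ W) ∪ shift 2₃ W

  ∈-orbit⁺ : ∀ W w {k} → E.rotate w k ∈ W → k ∈ orbit W
  ∈-orbit⁺ W zero             k∈ = x∈p∪q⁺ (inj₁ (x∈p∪q⁺ (inj₁ (subst (_∈ W) (E.rotate-0 _) k∈))))
  ∈-orbit⁺ W (suc zero)       k∈ = x∈p∪q⁺ (inj₁ (x∈p∪q⁺ (inj₂ (∈-reindex⁺ (E.rotate 1₃) k∈))))
  ∈-orbit⁺ W (suc (suc zero)) k∈ = x∈p∪q⁺ (inj₂ (∈-reindex⁺ (E.rotate 2₃) k∈))

  ∈-orbit⁻ : ∀ W {k} → k ∈ orbit W → ∃ λ w → E.rotate w k ∈ W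
  ∈-orbit⁻ W {k} k∈ with x∈p∪q⁻ (W ∪ shift 1₃ W) (shift 2₃ W) k∈
  ... | inj₂ k∈W₂ = 2₃ , ∈-reindex⁻ (E.rotate 2₃) k∈W₂
  ... | inj₁ k∈X with x∈p∪q⁻ W (shift 1₃ W) k∈X
  ...   | inj₁ k∈W  = 0₃ , subst (_∈ W) (sym (E.rotate-0 k)) k∈W
  ...   | inj₂ k∈W₁ = 1₃ , ∈-reindex⁻ (E.rotate 1₃) k∈W₁

  orbit-symmetric : ∀ W → Symmetric G (orbit W)
  orbit-symmetric W z k k∈ with ∈-orbit⁻ W k∈
  ... | w , wk∈W = ∈-orbit⁺ W (w -₃ z) (subst (_∈ W) (sym (begin
    E.rotate (w -₃ z) (E.rotate z k)  ≡⟨ E.rotate-∘ (w -₃ z) z k ⟩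
    E.rotate (z +₃ (w -₃ z)) k        ≡⟨ cong (λ u → E.rotate u k) (trans (+₃-comm z (w -₃ z)) (-₃-cancel w z)) ⟩
    E.rotate w k                      ∎)) wk∈W)
    where open ≡-Reasoning

  invariant⇒symmetric : ∀ W → W ⊆ shift 1₃ W → Symmetric G W
  invariant⇒symmetric W W⊆W₁ zero             k k∈ = subst (_∈ W) (sym (E.rotate-0 k)) k∈
  invariant⇒symmetric W W⊆W₁ (suc zero)       k k∈ = ∈-reindex⁻ (E.rotate 1₃) (W⊆W₁ k∈)
  invariant⇒symmetric W W⊆W₁ (suc (suc zero)) k k∈ =
    subst (_∈ W) (E.rotate-∘ 1₃ 1₃ k) (∈-reindex⁻ (E.rotate 1₃) (W⊆W₁ (∈-reindex⁻ (E.rotate 1₃) (W⊆W₁ k∈))))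

  ⊆-shift : ∀ {P W} → Symmetric G P → P ⊆ W → ∀ z → P ⊆ shift z W
  ⊆-shift sym-P P⊆W z {k} k∈ = ∈-reindex⁺ (E.rotate z) (P⊆W (sym-P z k k∈))

-- Every non-empty subgraph of a cone-Laman-sparse graph has m' ≤ 2n' − 1.
-- Whether the image is trivial need not be decided: if the (decidable) count
-- failed, the image could not be trivial, and the non-trivial case gives it.
cone-Laman-count : ∀ {n m} (G : ColGraph n m) → ConeLamanSparse G →
  ∀ T → Nonempty T → m' (graph G) T + 1 ≤ 2 * n' (graph G) T
cone-Laman-count G sparse T ne with m' (graph G) T + 1 ≤? 2 * n' (graph G) T
... | yes le = le
... | no ¬le = ⊥-elim (¬le (proj₂ (sparse T ne) (λ trivial → ¬le (weaken (proj₁ (sparse T ne) trivial)))))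
  where
  weaken : ∀ {a b} → a + 3 ≤ b → a + 1 ≤ b
  weaken {a} = ≤-trans (+-monoʳ-≤ a (s≤s z≤n))

module RigidComponent {n m : ℕ} (G : ColGraph n m) (sparse : ConeLamanSparse G) (G' : Subset m)
    (tight : Tight₂₁ (graph G) G') (maximal : ∀ T → Tight₂₁ (graph G) T → G' ⊆ T → T ≡ G') where
  open Development G
  open Orbits G

  P : Subset (m * 3)
  P = preimage G G'

  P-symmetric : Symmetric G P
  P-symmetric = preimage-symmetric G'

  P-tight : Tight₂₃ D P
  P-tight = Equivalence.to (preimage-tight G') tight

  -- Symmetric supersets of P are (2,3)-sparse, and (2,3)-tight only if equal
  -- to P: they are preimages of supersets of G', which the cone-Laman count
  -- and the maximality of G' control.
  symmetric-above : ∀ S → Symmetric G S → P ⊆ S → Sparse₂₃ D S × (Tight₂₃ D S → S ≡ P)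
  symmetric-above S sym-S P⊆S = subst (λ X → Sparse₂₃ D X × (Tight₂₃ D X → X ≡ P)) (sym S≡π⁻¹trace)
    (preimage-sparse trace (cone-Laman-count G sparse trace (proj₁ G'-nonempty , G'⊆trace (proj₂ G'-nonempty))) ,
     λ trace-tight → cong (preimage G) (maximal trace (Equivalence.from (preimage-tight trace) trace-tight) G'⊆trace))
    where
    trace : Subset m
    trace = reindex (λ e → combine e 0₃) S
    S≡π⁻¹trace : S ≡ preimage G trace
    S≡π⁻¹trace = symmetric⇒preimage S sym-S
    G'⊆trace : G' ⊆ trace
    G'⊆trace = preimage-reflects-⊆ (subst (P ⊆_) S≡π⁻¹trace P⊆S)
    G'-nonempty : Nonempty G'
    G'-nonempty = Tight₂₁⇒Nonempty H G' tight

  -- A superset W of P with defect 2 is impossible, provided all smaller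
  -- supersets of P are sparse: if W is not invariant, glue it with its
  -- translates along smaller (hence sparse) intersections; the union has
  -- defect 1 and is symmetric, or the full orbit has defect 0 — both
  -- contradicting symmetric-above.
  module _ (W : Subset (m * 3)) (smaller : ∀ {V} → ∣ V ∣ < ∣ W ∣ → P ⊆ V → Sparse₂₃ D V)
           (P⊆W : P ⊆ W) (dense-W : Dense D 2 W) where

    private
      W₁ W₂ X : Subset (m * 3)
      W₁ = shift 1₃ W
      W₂ = shift 2₃ W
      X  = W ∪ W₁

      P⊆X : P ⊆ X
      P⊆X k∈ = x∈p∪q⁺ (inj₁ (P⊆W k∈))

      contradict : ∀ {c} S → Symmetric G S → P ⊆ S → Dense D c S → c ≤ 2 → ⊥
      contradict S sym-S P⊆S = sparse-¬dense D S (proj₁ (symmetric-above S sym-S P⊆S))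

      dense-X : ∀ {x} → x ∈ W → x ∉ W₁ → Dense D 1 X
      dense-X x∈W x∉W₁ = dense-∪ D W W₁ dense-W (dense-shift 1₃ W dense-W)
        (smaller {W ∩ W₁} (∣p∩q∣<∣p∣ W W₁ x∈W x∉W₁) (λ k∈ → x∈p∩q⁺ (P⊆W k∈ , ⊆-shift P-symmetric P⊆W 1₃ k∈))) refl

      dense-orbit : ∀ {x y} → x ∈ W → x ∉ W₁ → y ∈ W₂ → y ∉ X → Dense D 0 (orbit W)
      dense-orbit x∈W x∉W₁ y∈W₂ y∉X = dense-∪ D X W₂ (dense-X x∈W x∉W₁) (dense-shift 2₃ W dense-W)
        (smaller {X ∩ W₂} (subst (∣ X ∩ W₂ ∣ <_) (m'-shift 2₃ W) (∣p∩q∣<∣q∣ X W₂ y∈W₂ y∉X))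
                 (λ k∈ → x∈p∩q⁺ (P⊆X k∈ , ⊆-shift P-symmetric P⊆W 2₃ k∈))) refl

      X≡orbit : W₂ ⊆ X → X ≡ orbit W
      X≡orbit W₂⊆X = ⊆-antisym (λ k∈ → x∈p∪q⁺ (inj₁ k∈)) (λ k∈ → [ (λ k∈X → k∈X) , W₂⊆X ]′ (x∈p∪q⁻ X W₂ k∈))

    defect-2-above-⊥ : ⊥
    defect-2-above-⊥ with ⊆-or-witness W W₁
    ... | inj₁ W⊆W₁ = contradict W (invariant⇒symmetric W W⊆W₁) P⊆W dense-W ≤-refl
    ... | inj₂ (x , x∈W , x∉W₁) with ⊆-or-witness W₂ X
    ...   | inj₁ W₂⊆X = contradict X (subst (Symmetric G) (sym (X≡orbit W₂⊆X)) (orbit-symmetric W))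
                          P⊆X (dense-X x∈W x∉W₁) (s≤s z≤n)
    ...   | inj₂ (y , y∈W₂ , y∉X) = contradict (orbit W) (orbit-symmetric W)
                          (λ k∈ → x∈p∪q⁺ (inj₁ (P⊆X k∈))) (dense-orbit x∈W x∉W₁ y∈W₂ y∉X) z≤n

  sparse-above : ∀ W → P ⊆ W → Sparse₂₃ D W
  sparse-above = All.wfRec (On.wellFounded ∣_∣ <-wellFounded) _ (λ W → P ⊆ W → Sparse₂₃ D W) step
    where
    step : ∀ W → (∀ {V} → ∣ V ∣ < ∣ W ∣ → P ⊆ V → Sparse₂₃ D V) → P ⊆ W → Sparse₂₃ D W
    step W smaller P⊆W with m' D W + 3 ≤? 2 * n' D W
    ... | yes sparse-W = sparse-W
    ... | no ¬sparse-W = ⊥-elim (defect-2-above-⊥ W smaller P⊆W (¬sparse⇒dense D W ¬sparse-W))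

  -- A (2,3)-tight U ⊇ P lies in its orbit, which is again tight (glued along
  -- sparse intersections) and symmetric, hence equal to P.
  P-maximal : ∀ U → Tight₂₃ D U → P ⊆ U → U ≡ P
  P-maximal U U-tight P⊆U = ⊆-antisym (λ k∈ → subst (_∈_ _) orbit≡P (x∈p∪q⁺ (inj₁ (x∈p∪q⁺ (inj₁ k∈))))) P⊆U
    where
    U₁ U₂ X : Subset (m * 3)
    U₁ = shift 1₃ U
    U₂ = shift 2₃ U
    X  = U ∪ U₁
    P⊆X : P ⊆ X
    P⊆X k∈ = x∈p∪q⁺ (inj₁ (P⊆U k∈))
    dense-U : Dense D 3 U
    dense-U = ≤-reflexive (sym U-tight)
    dense-X : Dense D 3 X
    dense-X = dense-∪ D U U₁ dense-U (dense-shift 1₃ U dense-U)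
      (sparse-above (U ∩ U₁) (λ k∈ → x∈p∩q⁺ (P⊆U k∈ , ⊆-shift P-symmetric P⊆U 1₃ k∈))) refl
    dense-orbit : Dense D 3 (orbit U)
    dense-orbit = dense-∪ D X U₂ dense-X (dense-shift 2₃ U dense-U)
      (sparse-above (X ∩ U₂) (λ k∈ → x∈p∩q⁺ (P⊆X k∈ , ⊆-shift P-symmetric P⊆U 2₃ k∈))) refl
    P⊆orbit : P ⊆ orbit U
    P⊆orbit k∈ = x∈p∪q⁺ (inj₁ (P⊆X k∈))
    orbit-above : Sparse₂₃ D (orbit U) × (Tight₂₃ D (orbit U) → orbit U ≡ P)
    orbit-above = symmetric-above (orbit U) (orbit-symmetric U) P⊆orbit
    orbit≡P : orbit U ≡ P
    orbit≡P = proj₂ orbit-above (sparse-dense-tight D (orbit U) (proj₁ orbit-above) dense-orbit)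

  preimage-component : Component23 D P
  preimage-component = P-tight , P-maximal

-- Backward direction: tightness descends along π, and maximality does because
-- taking preimages is monotone and reflects inclusion.
component⇒rigid : ∀ {n m} (G : ColGraph n m) (G' : Subset m) →
  Component23 (development G) (preimage G G') → ConeLamanRigidComponent G G'
component⇒rigid G G' (P-tight , P-maximal) = Equivalence.from (preimage-tight G') P-tight , maximal
  where
  open Development G
  maximal : ∀ T → Tight₂₁ H T → G' ⊆ T → T ≡ G'
  maximal T T-tight G'⊆T = ⊆-antisym (preimage-reflects-⊆ (λ k∈ → subst (_∈_ _) π⁻¹T≡π⁻¹G' k∈)) G'⊆T
    where
    π⁻¹T≡π⁻¹G' : preimage G T ≡ preimage G G'
    π⁻¹T≡π⁻¹G' = P-maximal (preimage G T) (Equivalence.to (preimage-tight T) T-tight) (preimage-mono G'⊆T)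

mainTheorem15 : ∀ (n m : ℕ) (G : ColGraph n m) → ConeLamanSparse G →
    ∀ (G' : Subset m) →
      ConeLamanRigidComponent G G'
        ⇔ (Symmetric G (preimage G G') × Component23 (development G) (preimage G G'))
mainTheorem15 n m G sparse G' = mk⇔
  (λ (tight , maximal) → Development.preimage-symmetric G G' ,
                          RigidComponent.preimage-component G sparse G' tight maximal)
  (λ (_ , component) → component⇒rigid G G' component)
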